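{- Let $w=\log_2 3$. Then, as $n\to\infty$, $a(n) = 2^{n}\left(1-\mathcal{O}\left(\frac{1}{n^w}\right)\right)$ and $b(n) = n\left(1-\mathcal{O}\left(\frac{1}{(\log n)^w}\right)\right)$.
   Context: $\mu$ is the morphism on binary words defined by $\mu(0)=01$, $\mu(1)=10$, with $n$-fold iterate $\mu^n$. $a(n)$ is the length of a longest common subsequence of $\mu^n(0)$ and $\mu^n(1)$. The Thue–Morse sequence $\mathbf{t}=t_0t_1\cdots$ is the fixed point of $\mu$ starting with $0$ (equivalently $t_i$ is the parity of the number of $1$'s in the binary expansion of $i$), and $b(n)$ is the length of a longest common subsequence of the length-$n$ prefix of $\mathbf{t}$ and its bitwise complement. -}

module Defs where

open import Data.Bool using (Bool; true; false; not)
open import Data.List using (List; []; _∷_; concatMap; take; map; length)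
open import Data.List.Relation.Binary.Sublist.Propositional using (_⊆_)
open import Data.Nat using (ℕ; zero; suc; _≤_; _<_; _^_; _*_; ∣_-_∣)
open import Data.Nat.Logarithm using (⌊log₂_⌋)
open import Data.Product using (Σ; _×_; ∃-syntax)
open import Relation.Binary.PropositionalEquality using (_≡_)

-- binary words: false = 0, true = 1
Word : Set
Word = List Bool

μ : Word → Word
μ = concatMap (λ x → x ∷ not x ∷ [])

μ^ : ℕ → Word → Word
μ^ zero    w = w
μ^ (suc n) w = μ (μ^ n w)

CommonSubseq : Word → Word → Word → Set
CommonSubseq u v w = (u ⊆ v) × (u ⊆ w)

IsLCSLength : Word → Word → ℕ → Set
IsLCSLength v w k =
  (∃[ u ] (CommonSubseq u v w × length u ≡ k))
  × (∀ u → CommonSubseq u v w → length u ≤ k)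

-- length-n prefix of the Thue–Morse word t (the fixed point of μ starting
-- with 0); since |μⁿ(0)| = 2ⁿ ≥ n, it is the length-n prefix of μⁿ(0)
tmPrefix : ℕ → Word
tmPrefix n = take n (μ^ n (false ∷ []))

complement : Word → Word
complement = map not

-- "x ≤ y / z^w" with w = log₂ 3, encoded without reals:
-- z^w · x ≤ y  ⇔  ∀ p q, q ≥ 1, p/q < log₂ 3 (i.e. 2^p < 3^q) → z^p · x^q ≤ y^q
-- (n^w = sup of n^{p/q} over rationals p/q < w, for z ≥ 1).
PowLog3Bound : ℕ → ℕ → ℕ → Set
PowLog3Bound z x y =
  ∀ p q → 1 ≤ q → 2 ^ p < 3 ^ q → z ^ p * x ^ q ≤ y ^ q

-- Let δ(n) = 2ⁿ − a(n) be the deficiency of an LCS of the blocks μⁿ(0) and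
-- μⁿ(1), the complement of μⁿ(0).
--
-- 1. Algebra of μ (blocks, lengths, complements) and the number of letter
--    changes of a word: μᵏ(0) has at most (2ᵏ⁺¹ − 1)/3 changes.
-- 2. Alignments: from a common subsequence u₀ of μᵐ(0), μᵐ(1) missing δ
--    letters we build common subsequences of (i) μᵐ⁺¹(w) and μᵐ⁺¹(w̄),
--    matched with a shift of one block, losing 2ᵐ plus δ per change of w,
--    and (ii) the length-n prefixes of μᵐ(w) and μᵐ(w̄), matched block by
--    block, losing at most n δ / 2ᵐ + 2ᵐ.
-- 3. Exponent arithmetic.  PowLog3Bound z x y encodes z^(log₂ 3) x ≤ y; a
--    bound 3ⁱ x ≤ Y with z < 2ⁱ⁺¹ yields it for y = 3Y.
-- 4. Block deficiency: (i) with w = μᴺ⁻¹(0), N = 2ʲ, gives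
--    δ(2N) ≤ 2ᴺ + (2ᴺ/3) δ(N), hence 3ʲ δ(2ʲ) ≤ 17 · 2^(2ʲ); together with
--    δ(n + 1) ≤ 2 δ(n) this becomes 3^⌊log₂ n⌋ δ(n) ≤ 17 · 2ⁿ.
-- 5. Prefix deficiency: (ii) with M = 2ⁱ, i + 1 = ⌊log₂ ⌊log₂ n⌋⌋, and the
--    bound of 4 for δ(M) give 3^⌊log₂ ⌊log₂ n⌋⌋ (n − b(n)) ≤ 54 n.

module Submission where

open import Defs
open import Data.Bool using (Bool; true; false; not)
open import Data.Bool.Properties using (not-involutive)
open import Data.List using (List; []; _∷_; _++_; length; take)
open import Data.List.Properties using (length-++; take-map; length-take)
open import Data.List.Relation.Binary.Sublist.Propositional using (_⊆_; ⊆-refl; minimum)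
open import Data.List.Relation.Binary.Sublist.Propositional.Properties using (++⁺ˡ; ++⁺ʳ; ++⁺; length-mono-≤)
open import Data.Nat
open import Data.Nat.Properties
open import Data.Nat.Logarithm using (⌊log₂_⌋; ⌊log₂⌋-mono-≤; ⌊log₂[2^n]⌋≡n; ⌊log₂⌊n/2⌋⌋≡⌊log₂n⌋∸1)
open import Data.Nat.Tactic.RingSolver using (solve-∀)
open import Algebra.Properties.CommutativeSemigroup *-commutativeSemigroup using (x∙yz≈y∙xz)
open import Data.Product using (_×_; _,_; proj₁; proj₂; ∃-syntax)
open import Data.Sum using (_⊎_; inj₁; inj₂)
open import Relation.Nullary using (yes; no; contradiction)
open import Relation.Binary.PropositionalEquality

μ-++ : ∀ xs ys → μ (xs ++ ys) ≡ μ xs ++ μ ys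
μ-++ []       ys = refl
μ-++ (x ∷ xs) ys = cong (λ zs → x ∷ not x ∷ zs) (μ-++ xs ys)

μ^-++ : ∀ n xs ys → μ^ n (xs ++ ys) ≡ μ^ n xs ++ μ^ n ys
μ^-++ zero    xs ys = refl
μ^-++ (suc n) xs ys = trans (cong μ (μ^-++ n xs ys)) (μ-++ (μ^ n xs) (μ^ n ys))

μ^-+ : ∀ m k w → μ^ (m + k) w ≡ μ^ m (μ^ k w)
μ^-+ zero    k w = refl
μ^-+ (suc m) k w = cong μ (μ^-+ m k w)

μ^-complement : ∀ n w → μ^ n (complement w) ≡ complement (μ^ n w)
μ^-complement zero    w = refl
μ^-complement (suc n) w = trans (cong μ (μ^-complement n w)) (μ-complement (μ^ n w))
  where
  μ-complement : ∀ w → μ (complement w) ≡ complement (μ w)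
  μ-complement []      = refl
  μ-complement (c ∷ w) = cong (λ zs → not c ∷ not (not c) ∷ zs) (μ-complement w)

block : ℕ → Bool → Word
block m c = μ^ m (c ∷ [])

μ^-∷ : ∀ m c w → μ^ m (c ∷ w) ≡ block m c ++ μ^ m w
μ^-∷ m c w = μ^-++ m (c ∷ []) w

μ^μ-∷ : ∀ m c w → μ^ m (μ (c ∷ w)) ≡ block m c ++ (block m (not c) ++ μ^ m (μ w))
μ^μ-∷ m c w = trans (μ^-∷ m c _) (cong (block m c ++_) (μ^-∷ m (not c) (μ w)))

block-suc : ∀ m c → block (suc m) c ≡ block m c ++ block m (not c)
block-suc m c = begin
    μ^ (suc m) (c ∷ [])       ≡⟨ cong (λ k → μ^ k (c ∷ [])) (+-comm 1 m) ⟩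
    μ^ (m + 1) (c ∷ [])       ≡⟨ μ^-+ m 1 (c ∷ []) ⟩
    μ^ m (c ∷ not c ∷ [])     ≡⟨ μ^-∷ m c (not c ∷ []) ⟩
    block m c ++ block m (not c) ∎
  where open ≡-Reasoning

block-true : ∀ n → block n true ≡ complement (block n false)
block-true n = μ^-complement n (false ∷ [])

block-head : ∀ k c → ∃[ x ] block k c ≡ c ∷ x
block-head zero    c = [] , refl
block-head (suc k) c with block-head k c
... | x , eq = not c ∷ μ x , cong μ eq

length-μ^ : ∀ n w → length (μ^ n w) ≡ 2 ^ n * length w
length-μ^ zero    w = sym (+-identityʳ (length w))
length-μ^ (suc n) w = begin
    length (μ (μ^ n w))          ≡⟨ length-μ (μ^ n w) ⟩
    2 * length (μ^ n w)          ≡⟨ cong (2 *_) (length-μ^ n w) ⟩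
    2 * (2 ^ n * length w)       ≡⟨ *-assoc 2 (2 ^ n) (length w) ⟨
    2 ^ suc n * length w         ∎
  where
  open ≡-Reasoning
  length-μ : ∀ w → length (μ w) ≡ 2 * length w
  length-μ []      = refl
  length-μ (c ∷ w) = trans (cong (2 +_) (length-μ w)) (sym (*-suc 2 (length w)))

length-block : ∀ m c → length (block m c) ≡ 2 ^ m
length-block m c = trans (length-μ^ m (c ∷ [])) (*-identityʳ (2 ^ m))

differ : Bool → Bool → ℕ
differ true  true  = 0
differ false false = 0
differ true  false = 1
differ false true  = 1

differ-not : ∀ c → differ c (not c) ≡ 1
differ-not true  = refl
differ-not false = refl

differ-not-+ : ∀ c e → differ (not c) e + differ c e ≡ 1
differ-not-+ true  true  = refl
differ-not-+ true  false = refl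
differ-not-+ false true  = refl
differ-not-+ false false = refl

changesFrom : Bool → Word → ℕ
changesFrom c []      = 0
changesFrom c (e ∷ w) = differ c e + changesFrom e w

changes : Word → ℕ
changes []      = 0
changes (c ∷ w) = changesFrom c w

-- In μ(w) every two-letter block c c̄ is a change, and the boundary between
-- the blocks of consecutive letters c, e of w is a change iff c = e; so
-- changes of μ(w) and of w add up to 2|w|.
changesFrom-μ : ∀ c w → changesFrom (not c) (μ w) + changesFrom c w ≡ 2 * length w
changesFrom-μ c []      = refl
changesFrom-μ c (e ∷ w) = begin
    (differ (not c) e + (differ e (not e) + X)) + (differ c e + Y)
  ≡⟨ regroup (differ (not c) e) (differ c e) (differ e (not e)) X Y ⟩
    (differ (not c) e + differ c e) + differ e (not e) + (X + Y)
  ≡⟨ cong₂ (λ p q → p + differ e (not e) + q) (differ-not-+ c e) (changesFrom-μ e w) ⟩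
    1 + differ e (not e) + 2 * length w
  ≡⟨ cong (λ r → 1 + r + 2 * length w) (differ-not e) ⟩
    2 + 2 * length w
  ≡⟨ *-suc 2 (length w) ⟨
    2 * length (e ∷ w) ∎
  where
  open ≡-Reasoning
  X Y : ℕ
  X = changesFrom (not e) (μ w)
  Y = changesFrom e w
  regroup : ∀ p q r x y → (p + (r + x)) + (q + y) ≡ (p + q) + r + (x + y)
  regroup = solve-∀

-- For a nonempty word cw the change c c̄ opening μ(cw) adds one more.
changes-μ : ∀ c w → changes (μ (c ∷ w)) + changes (c ∷ w) + 1 ≡ 2 * length (c ∷ w)
changes-μ c w = begin
    differ c (not c) + X + Y + 1    ≡⟨ cong (λ r → r + X + Y + 1) (differ-not c) ⟩
    1 + X + Y + 1                   ≡⟨ regroup X Y ⟩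
    2 + (X + Y)                     ≡⟨ cong (2 +_) (changesFrom-μ c w) ⟩
    2 + 2 * length w                ≡⟨ *-suc 2 (length w) ⟨
    2 * length (c ∷ w)              ∎
  where
  open ≡-Reasoning
  X Y : ℕ
  X = changesFrom (not c) (μ w)
  Y = changesFrom c w
  regroup : ∀ x y → 1 + x + y + 1 ≡ 2 + (x + y)
  regroup = solve-∀

changes-block-step : ∀ k → changes (block (suc k) false) + changes (block k false) + 1 ≡ 2 ^ suc k
changes-block-step k with block-head k false
... | x , eq = begin
    changes (μ (block k false)) + changes (block k false) + 1
  ≡⟨ cong (λ w → changes (μ w) + changes w + 1) eq ⟩
    changes (μ (false ∷ x)) + changes (false ∷ x) + 1
  ≡⟨ changes-μ false x ⟩
    2 * length (false ∷ x)
  ≡⟨ cong (λ w → 2 * length w) eq ⟨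
    2 * length (block k false)
  ≡⟨ cong (2 *_) (length-block k false) ⟩
    2 ^ suc k ∎
  where open ≡-Reasoning

thirds-step : ∀ C C′ T r s → C′ + C + 1 ≡ T → 3 * C + r ≡ T → r + s ≡ 3 → 3 * C′ + s ≡ 2 * T
thirds-step C C′ T r s sum≡T 3C+r≡T r+s≡3 = +-cancelʳ-≡ T (3 * C′ + s) (2 * T) (begin
    3 * C′ + s + T              ≡⟨ cong (3 * C′ + s +_) 3C+r≡T ⟨
    3 * C′ + s + (3 * C + r)    ≡⟨ regroup C C′ r s ⟩
    3 * (C′ + C) + (r + s)      ≡⟨ cong (3 * (C′ + C) +_) r+s≡3 ⟩
    3 * (C′ + C) + 3            ≡⟨ distrib C C′ ⟩
    3 * (C′ + C + 1)            ≡⟨ cong (3 *_) sum≡T ⟩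
    3 * T                       ≡⟨ triple T ⟩
    2 * T + T                   ∎)
  where
  open ≡-Reasoning
  regroup : ∀ C C′ r s → 3 * C′ + s + (3 * C + r) ≡ 3 * (C′ + C) + (r + s)
  regroup = solve-∀
  distrib : ∀ C C′ → 3 * (C′ + C) + 3 ≡ 3 * (C′ + C + 1)
  distrib = solve-∀
  triple : ∀ T → 3 * T ≡ 2 * T + T
  triple = solve-∀

changes-block-exact : ∀ k → (3 * changes (block k false) + 1 ≡ 2 ^ suc k)
                          ⊎ (3 * changes (block k false) + 2 ≡ 2 ^ suc k)
changes-block-exact zero = inj₂ refl
changes-block-exact (suc k) = alternate (changes-block-exact k)
  where
  C C′ T : ℕ
  C  = changes (block k false)
  C′ = changes (block (suc k) false)
  T  = 2 ^ suc k
  alternate : (3 * C + 1 ≡ T) ⊎ (3 * C + 2 ≡ T) → (3 * C′ + 1 ≡ 2 * T) ⊎ (3 * C′ + 2 ≡ 2 * T)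
  alternate (inj₁ e) = inj₂ (thirds-step C C′ T 1 2 (changes-block-step k) e refl)
  alternate (inj₂ e) = inj₁ (thirds-step C C′ T 2 1 (changes-block-step k) e refl)

changes-block-bound : ∀ k → 3 * changes (block k false) + 1 ≤ 2 ^ suc k
changes-block-bound k with changes-block-exact k
... | inj₁ e = ≤-reflexive e
... | inj₂ e = ≤-trans (+-monoʳ-≤ (3 * changes (block k false)) (s≤s z≤n)) (≤-reflexive e)

take-++-≥ : ∀ {A : Set} (xs ys : List A) n → length xs ≤ n → take n (xs ++ ys) ≡ xs ++ take (n ∸ length xs) ys
take-++-≥ []       ys n       _          = refl
take-++-≥ (x ∷ xs) ys (suc n) (s≤s |xs|≤n) = cong (x ∷_) (take-++-≥ xs ys n |xs|≤n)

prefix⁺ : ∀ {A : Set} (xs : List A) {ys zs : List A} → ys ⊆ zs → xs ++ ys ⊆ xs ++ zs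
prefix⁺ xs = ++⁺ (⊆-refl {x = xs})

module Alignment (m : ℕ) (u₀ : Word) (u₀⊆block₀ : u₀ ⊆ block m false) (u₀⊆block₁ : u₀ ⊆ block m true)
                 (δ : ℕ) (|u₀|+δ : length u₀ + δ ≡ 2 ^ m) where

  T : ℕ
  T = 2 ^ m

  u₀⊆block : ∀ c → u₀ ⊆ block m c
  u₀⊆block false = u₀⊆block₀
  u₀⊆block true  = u₀⊆block₁

  piece : Bool → Bool → Word
  piece true  true  = block m true
  piece false false = block m false
  piece _     _     = u₀

  piece⊆ˡ : ∀ c e → piece c e ⊆ block m c
  piece⊆ˡ true  true  = ⊆-refl
  piece⊆ˡ false false = ⊆-refl
  piece⊆ˡ true  false = u₀⊆block₁
  piece⊆ˡ false true  = u₀⊆block₀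

  piece⊆ʳ : ∀ c e → piece c e ⊆ block m e
  piece⊆ʳ true  true  = ⊆-refl
  piece⊆ʳ false false = ⊆-refl
  piece⊆ʳ true  false = u₀⊆block₀
  piece⊆ʳ false true  = u₀⊆block₁

  length-piece : ∀ c e → length (piece c e) + differ c e * δ ≡ T
  length-piece true  true  = trans (+-identityʳ _) (length-block m true)
  length-piece false false = trans (+-identityʳ _) (length-block m false)
  length-piece true  false = trans (cong (length u₀ +_) (*-identityˡ δ)) |u₀|+δ
  length-piece false true  = trans (cong (length u₀ +_) (*-identityˡ δ)) |u₀|+δ

  -- The shifted alignment.  μᵐ⁺¹(c x₁ … xₗ) = μᵐ(c) μᵐ(c̄) μᵐ(x₁) μᵐ(x̄₁) …
  -- and its complement μᵐ(c̄) μᵐ(c) μᵐ(x̄₁) μᵐ(x₁) … are matched with the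
  -- second one shifted by one block: each μᵐ(x̄ᵢ) with itself, and μᵐ(xᵢ₊₁)
  -- with μᵐ(xᵢ) (x₀ = c) through a piece.
  shifted : Bool → Word → Word
  shifted c []      = block m (not c)
  shifted c (e ∷ x) = block m (not c) ++ (piece c e ++ shifted e x)

  shifted⊆tail : ∀ c x → shifted c x ⊆ block m (not c) ++ μ^ m (μ x)
  shifted⊆tail c []      = ++⁺ʳ _ ⊆-refl
  shifted⊆tail c (e ∷ x) = subst (shifted c (e ∷ x) ⊆_) (cong (block m (not c) ++_) (sym (μ^μ-∷ m e x)))
                             (prefix⁺ (block m (not c)) (++⁺ (piece⊆ʳ c e) (shifted⊆tail e x)))

  shifted⊆μ : ∀ c x → shifted c x ⊆ μ^ m (μ (c ∷ x))
  shifted⊆μ c x = subst (shifted c x ⊆_) (sym (μ^μ-∷ m c x)) (++⁺ˡ (block m c) (shifted⊆tail c x))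

  shifted⊆complement : ∀ c x → shifted c x ⊆ μ^ m (μ (complement (c ∷ x)))
  shifted⊆complement c []      = subst (block m (not c) ⊆_) (sym (μ^-∷ m (not c) _)) (++⁺ʳ _ ⊆-refl)
  shifted⊆complement c (e ∷ x) = subst (shifted c (e ∷ x) ⊆_) (sym unfold)
                                   (prefix⁺ (block m (not c)) (++⁺ (piece⊆ˡ c e) (shifted⊆complement e x)))
    where
    unfold : μ^ m (μ (complement (c ∷ e ∷ x)))
             ≡ block m (not c) ++ (block m c ++ μ^ m (μ (complement (e ∷ x))))
    unfold = trans (μ^μ-∷ m (not c) (complement (e ∷ x)))
                   (cong (λ c′ → block m (not c) ++ (block m c′ ++ _)) (not-involutive c))

  length-shifted : ∀ c x → length (shifted c x) + T + changesFrom c x * δ ≡ length (c ∷ x) * (2 * T)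
  length-shifted c []      = trans (cong (λ l → l + T + 0) (length-block m (not c))) (single T)
    where
    single : ∀ T → T + T + 0 ≡ 1 * (2 * T)
    single = solve-∀
  length-shifted c (e ∷ x) = begin
      length (block m (not c) ++ (piece c e ++ shifted e x)) + T + (differ c e + changesFrom e x) * δ
    ≡⟨ cong (λ l → l + T + (differ c e + changesFrom e x) * δ) lengths ⟩
      T + (length (piece c e) + length (shifted e x)) + T + (differ c e + changesFrom e x) * δ
    ≡⟨ regroup T (length (piece c e)) (length (shifted e x)) (differ c e) (changesFrom e x) δ ⟩
      T + (length (piece c e) + differ c e * δ) + (length (shifted e x) + T + changesFrom e x * δ)
    ≡⟨ cong₂ (λ p q → T + p + q) (length-piece c e) (length-shifted e x) ⟩
      T + T + length (e ∷ x) * (2 * T)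
    ≡⟨ one-more T (length x) ⟩
      length (c ∷ e ∷ x) * (2 * T) ∎
    where
    open ≡-Reasoning
    lengths : length (block m (not c) ++ (piece c e ++ shifted e x))
              ≡ T + (length (piece c e) + length (shifted e x))
    lengths = trans (length-++ (block m (not c))) (cong₂ _+_ (length-block m (not c)) (length-++ (piece c e)))
    regroup : ∀ T p w r s δ → T + (p + w) + T + (r + s) * δ ≡ T + (p + r * δ) + (w + T + s * δ)
    regroup = solve-∀
    one-more : ∀ T l → T + T + suc l * (2 * T) ≡ suc (suc l) * (2 * T)
    one-more = solve-∀

  -- The block-by-block alignment of prefixes: the first n letters of μᵐ(x)
  -- and of its complement μᵐ(x̄) are matched one pair of complementary
  -- blocks at a time through u₀, losing δ letters per full block and fewer
  -- than 2ᵐ letters in the last, partial block.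
  prefix-alignment : ∀ x n → n ≤ length x * T
    → ∃[ u ] (u ⊆ take n (μ^ m x)) × (u ⊆ take n (μ^ m (complement x)))
              × (T * n ≤ T * length u + n * δ + T * T)
  prefix-alignment x n n≤|x|T with n <? T
  ... | yes n<T = [] , minimum _ , minimum _ , ≤-trans (*-monoʳ-≤ T (<⇒≤ n<T)) (m≤n+m (T * T) _)
  prefix-alignment [] n n≤0 | no n≮T = contradiction (≤-<-trans n≤0 (m^n>0 2 m)) n≮T
  prefix-alignment (c ∷ x) n n≤|cx|T | no n≮T
    with prefix-alignment x (n ∸ T) (m≤n+o⇒m∸n≤o n T n≤|cx|T)
  ... | u , u⊆x , u⊆x̄ , bound = u₀ ++ u , u₀u⊆cx , u₀u⊆c̄x̄ , bound′
    where
    T≤n : T ≤ n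
    T≤n = ≮⇒≥ n≮T
    take-block : ∀ c y → take n (μ^ m (c ∷ y)) ≡ block m c ++ take (n ∸ T) (μ^ m y)
    take-block c y = begin
        take n (μ^ m (c ∷ y))                                       ≡⟨ cong (take n) (μ^-∷ m c y) ⟩
        take n (block m c ++ μ^ m y)                                ≡⟨ take-++-≥ (block m c) _ n |block|≤n ⟩
        block m c ++ take (n ∸ length (block m c)) (μ^ m y)         ≡⟨ cong (λ l → block m c ++ take (n ∸ l) _) (length-block m c) ⟩
        block m c ++ take (n ∸ T) (μ^ m y)                          ∎
      where
      open ≡-Reasoning
      |block|≤n : length (block m c) ≤ n
      |block|≤n = subst (_≤ n) (sym (length-block m c)) T≤n
    u₀u⊆cx : u₀ ++ u ⊆ take n (μ^ m (c ∷ x))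
    u₀u⊆cx = subst (u₀ ++ u ⊆_) (sym (take-block c x)) (++⁺ (u₀⊆block c) u⊆x)
    u₀u⊆c̄x̄ : u₀ ++ u ⊆ take n (μ^ m (complement (c ∷ x)))
    u₀u⊆c̄x̄ = subst (u₀ ++ u ⊆_) (sym (take-block (not c) (complement x))) (++⁺ (u₀⊆block (not c)) u⊆x̄)
    bound′ : T * n ≤ T * length (u₀ ++ u) + n * δ + T * T
    bound′ = begin
        T * n                                                       ≡⟨ cong (T *_) (m+[n∸m]≡n T≤n) ⟨
        T * (T + (n ∸ T))                                           ≡⟨ *-distribˡ-+ T T (n ∸ T) ⟩
        T * T + T * (n ∸ T)                                         ≤⟨ +-monoʳ-≤ (T * T) bound ⟩
        T * T + (T * length u + (n ∸ T) * δ + T * T)                ≡⟨ cong (λ t → t * T + (T * length u + (n ∸ T) * δ + T * T)) |u₀|+δ ⟨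
        (length u₀ + δ) * T + (T * length u + (n ∸ T) * δ + T * T)  ≡⟨ regroup T (length u₀) (length u) δ (n ∸ T) ⟩
        T * (length u₀ + length u) + (T + (n ∸ T)) * δ + T * T      ≡⟨ cong₂ (λ l k → T * l + k * δ + T * T) (sym (length-++ u₀)) (m+[n∸m]≡n T≤n) ⟩
        T * length (u₀ ++ u) + n * δ + T * T                        ∎
      where
      open ≤-Reasoning
      regroup : ∀ T a l δ r → (a + δ) * T + (T * l + r * δ + T * T) ≡ T * (a + l) + (T + r) * δ + T * T
      regroup = solve-∀

*-^-distrib : ∀ x y o → (x * y) ^ o ≡ x ^ o * y ^ o
*-^-distrib x y zero    = refl
*-^-distrib x y (suc o) = trans (cong (x * y *_) (*-^-distrib x y o)) ([m*n]*[o*p]≡[m*o]*[n*p] x y (x ^ o) (y ^ o))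

^-swap : ∀ m p q → (m ^ p) ^ q ≡ (m ^ q) ^ p
^-swap m p q = trans (^-*-assoc m p q) (trans (cong (m ^_) (*-comm p q)) (sym (^-*-assoc m q p)))

-- The exponent conversion.  PowLog3Bound z x y says z^(log₂ 3) x ≤ y, i.e.
-- zᵖ xᵠ ≤ yᵠ whenever 2ᵖ < 3ᵠ.  If z < 2ⁱ⁺¹ then zᵖ < 2ᵖ (2ᵖ)ⁱ < 3ᵠ (3ⁱ)ᵠ,
-- so a bound 3ⁱ x ≤ Y gives it with y = 3Y.
PowLog3Bound-intro : ∀ z x Y i → z < 2 ^ suc i → 3 ^ i * x ≤ Y → PowLog3Bound z x (3 * Y)
PowLog3Bound-intro z x Y i z<2^[1+i] 3^ix≤Y p q _ 2^p<3^q = begin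
    z ^ p * x ^ q
  ≤⟨ *-monoˡ-≤ (x ^ q) (^-monoˡ-≤ p (<⇒≤ z<2^[1+i])) ⟩
    (2 * 2 ^ i) ^ p * x ^ q
  ≡⟨ cong (_* x ^ q) (trans (*-^-distrib 2 (2 ^ i) p) (cong (2 ^ p *_) (^-swap 2 i p))) ⟩
    2 ^ p * (2 ^ p) ^ i * x ^ q
  ≤⟨ *-monoˡ-≤ (x ^ q) (*-mono-≤ (<⇒≤ 2^p<3^q) (^-monoˡ-≤ i (<⇒≤ 2^p<3^q))) ⟩
    3 ^ q * (3 ^ q) ^ i * x ^ q
  ≡⟨ *-assoc (3 ^ q) ((3 ^ q) ^ i) (x ^ q) ⟩
    3 ^ q * ((3 ^ q) ^ i * x ^ q)
  ≡⟨ cong (λ t → 3 ^ q * (t * x ^ q)) (^-swap 3 q i) ⟩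
    3 ^ q * ((3 ^ i) ^ q * x ^ q)
  ≡⟨ cong (3 ^ q *_) (*-^-distrib (3 ^ i) x q) ⟨
    3 ^ q * (3 ^ i * x) ^ q
  ≤⟨ *-monoʳ-≤ (3 ^ q) (^-monoˡ-≤ q 3^ix≤Y) ⟩
    3 ^ q * Y ^ q
  ≡⟨ *-^-distrib 3 Y q ⟨
    (3 * Y) ^ q ∎
  where open ≤-Reasoning

n<2^suc⌊log₂n⌋ : ∀ n → n < 2 ^ suc ⌊log₂ n ⌋
n<2^suc⌊log₂n⌋ n with n <? 2 ^ suc ⌊log₂ n ⌋
... | yes n<2^[1+L] = n<2^[1+L]
... | no  n≮2^[1+L] = contradiction 1+L≤L (n≮n ⌊log₂ n ⌋)
  where
  1+L≤L : suc ⌊log₂ n ⌋ ≤ ⌊log₂ n ⌋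
  1+L≤L = subst (_≤ ⌊log₂ n ⌋) (⌊log₂[2^n]⌋≡n (suc ⌊log₂ n ⌋)) (⌊log₂⌋-mono-≤ (≮⇒≥ n≮2^[1+L]))

2*⌊n/2⌋≤n : ∀ n → 2 * ⌊ n /2⌋ ≤ n
2*⌊n/2⌋≤n n = begin
    ⌊ n /2⌋ + (⌊ n /2⌋ + 0)   ≡⟨ cong (⌊ n /2⌋ +_) (+-identityʳ ⌊ n /2⌋) ⟩
    ⌊ n /2⌋ + ⌊ n /2⌋         ≤⟨ +-monoʳ-≤ ⌊ n /2⌋ (⌊n/2⌋≤⌈n/2⌉ n) ⟩
    ⌊ n /2⌋ + ⌈ n /2⌉         ≡⟨ ⌊n/2⌋+⌈n/2⌉≡n n ⟩
    n                         ∎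
  where open ≤-Reasoning

2^⌊log₂n⌋≤n : ∀ n → 1 ≤ n → 2 ^ ⌊log₂ n ⌋ ≤ n
2^⌊log₂n⌋≤n n = 2^L≤n ⌊log₂ n ⌋ n refl
  where
  2^L≤n : ∀ L n → ⌊log₂ n ⌋ ≡ L → 1 ≤ n → 2 ^ L ≤ n
  2^L≤n zero    n                _  1≤n = 1≤n
  2^L≤n (suc L) (suc zero)       () _
  2^L≤n (suc L) n@(suc (suc k)) log≡ _   = ≤-trans (*-monoʳ-≤ 2 2^L≤half) (2*⌊n/2⌋≤n n)
    where
    2^L≤half : 2 ^ L ≤ ⌊ n /2⌋
    2^L≤half = 2^L≤n L ⌊ n /2⌋ (trans (⌊log₂⌊n/2⌋⌋≡⌊log₂n⌋∸1 n) (cong (_∸ 1) log≡)) (s≤s z≤n)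

n≤2^n : ∀ n → n ≤ 2 ^ n
n≤2^n zero    = z≤n
n≤2^n (suc n) = begin
    1 + n              ≤⟨ +-mono-≤ (m^n>0 2 n) (n≤2^n n) ⟩
    2 ^ n + 2 ^ n      ≡⟨ cong (2 ^ n +_) (+-identityʳ (2 ^ n)) ⟨
    2 ^ suc n          ∎
  where open ≤-Reasoning

2^2^suc : ∀ j → 2 ^ (2 ^ suc j) ≡ 2 ^ (2 ^ j) * 2 ^ (2 ^ j)
2^2^suc j = trans (cong (λ e → 2 ^ (2 ^ j + e)) (+-identityʳ (2 ^ j))) (^-distribˡ-+-* 2 (2 ^ j) (2 ^ j))

2^2^-mono : ∀ {j k} → j ≤ k → 2 ^ (2 ^ j) ≤ 2 ^ (2 ^ k)
2^2^-mono j≤k = ^-monoʳ-≤ 2 (^-monoʳ-≤ 2 j≤k)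

square-step : ∀ a x c j → a ≤ 2 ^ (2 ^ j) → x ≤ c * 2 ^ (2 ^ j) → a * x ≤ c * 2 ^ (2 ^ suc j)
square-step a x c j a≤Q x≤cQ = begin
    a * x              ≤⟨ *-mono-≤ a≤Q x≤cQ ⟩
    Q * (c * Q)        ≡⟨ rearrange Q c ⟩
    c * (Q * Q)        ≡⟨ cong (c *_) (2^2^suc j) ⟨
    c * 2 ^ (2 ^ suc j) ∎
  where
  open ≤-Reasoning
  Q : ℕ
  Q = 2 ^ (2 ^ j)
  rearrange : ∀ Q c → Q * (c * Q) ≡ c * (Q * Q)
  rearrange = solve-∀

3^i≤2^2^i : ∀ i → 3 ^ i ≤ 2 ^ (2 ^ i)
3^i≤2^2^i zero          = s≤s z≤n
3^i≤2^2^i (suc zero)    = ≤ᵇ⇒≤ 3 4 _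
3^i≤2^2^i (suc (suc i)) = subst (3 ^ suc (suc i) ≤_) (*-identityˡ _)
  (square-step 3 (3 ^ suc i) 1 (suc i) (≤-trans (≤ᵇ⇒≤ 3 4 _) (2^2^-mono {1} {suc i} (s≤s z≤n)))
               (subst (3 ^ suc i ≤_) (sym (*-identityˡ _)) (3^i≤2^2^i (suc i))))

6^suc≤16*2^2^j : ∀ j → 6 ^ suc j ≤ 16 * 2 ^ (2 ^ j)
6^suc≤16*2^2^j zero                = ≤ᵇ⇒≤ 6 32 _
6^suc≤16*2^2^j (suc zero)          = ≤ᵇ⇒≤ 36 64 _
6^suc≤16*2^2^j (suc (suc zero))    = ≤ᵇ⇒≤ 216 256 _
6^suc≤16*2^2^j (suc (suc (suc j))) =
  square-step 6 (6 ^ suc (suc (suc j))) 16 (suc (suc j))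
              (≤-trans (≤ᵇ⇒≤ 6 16 _) (2^2^-mono {2} {suc (suc j)} (s≤s (s≤s z≤n))))
              (6^suc≤16*2^2^j (suc (suc j)))

invariant-step : ∀ X D D′ C Q N → X * D + 16 * Q ≤ 17 * N * Q → D′ ≤ Q + C * D → 3 * C ≤ Q → 6 * X ≤ 16 * Q
                 → 6 * X * D′ + 16 * (Q * Q) ≤ 17 * (2 * N) * (Q * Q)
invariant-step X D D′ C Q N inv D′≤ 3C≤Q 6X≤16Q = begin
    6 * X * D′ + 16 * (Q * Q)
  ≤⟨ +-monoˡ-≤ (16 * (Q * Q)) (*-monoʳ-≤ (6 * X) D′≤) ⟩
    6 * X * (Q + C * D) + 16 * (Q * Q)
  ≡⟨ expand X D C Q ⟩
    (6 * X) * Q + (3 * C) * (2 * (X * D)) + 16 * (Q * Q)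
  ≤⟨ +-monoˡ-≤ (16 * (Q * Q)) (+-mono-≤ (*-monoˡ-≤ Q 6X≤16Q) (*-monoˡ-≤ (2 * (X * D)) 3C≤Q)) ⟩
    (16 * Q) * Q + Q * (2 * (X * D)) + 16 * (Q * Q)
  ≡⟨ collect X D Q ⟩
    2 * Q * (X * D + 16 * Q)
  ≤⟨ *-monoʳ-≤ (2 * Q) inv ⟩
    2 * Q * (17 * N * Q)
  ≡⟨ rearrange N Q ⟩
    17 * (2 * N) * (Q * Q) ∎
  where
  open ≤-Reasoning
  expand : ∀ X D C Q → 6 * X * (Q + C * D) + 16 * (Q * Q) ≡ (6 * X) * Q + (3 * C) * (2 * (X * D)) + 16 * (Q * Q)
  expand = solve-∀
  collect : ∀ X D Q → (16 * Q) * Q + Q * (2 * (X * D)) + 16 * (Q * Q) ≡ 2 * Q * (X * D + 16 * Q)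
  collect = solve-∀
  rearrange : ∀ N Q → 2 * Q * (17 * N * Q) ≡ 17 * (2 * N) * (Q * Q)
  rearrange = solve-∀

module BlockDeficiency (a : ℕ → ℕ) (lcs-a : ∀ n → IsLCSLength (block n false) (block n true) (a n)) where

  δ : ℕ → ℕ
  δ n = 2 ^ n ∸ a n

  a≤2^n : ∀ n → a n ≤ 2 ^ n
  a≤2^n n with proj₁ (lcs-a n)
  ... | u , (u⊆block₀ , _) , |u|≡a = subst (_≤ 2 ^ n) |u|≡a
                                       (≤-trans (length-mono-≤ u⊆block₀) (≤-reflexive (length-block n false)))

  optimal : ∀ n → ∃[ u ] (u ⊆ block n false) × (u ⊆ block n true) × (length u + δ n ≡ 2 ^ n)
  optimal n with proj₁ (lcs-a n)
  ... | u , (u⊆block₀ , u⊆block₁) , |u|≡a =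
    u , u⊆block₀ , u⊆block₁ , trans (cong (_+ δ n) |u|≡a) (m+[n∸m]≡n (a≤2^n n))

  δ≤ : ∀ n D u → u ⊆ block n false → u ⊆ block n true → 2 ^ n ≤ length u + D → δ n ≤ D
  δ≤ n D u u⊆block₀ u⊆block₁ 2^n≤ = m≤n+o⇒m∸n≤o (2 ^ n) (a n)
    (≤-trans 2^n≤ (+-monoˡ-≤ D (proj₂ (lcs-a n) u (u⊆block₀ , u⊆block₁))))

  -- μᵐ⁺¹(0) = μᵐ(0)μᵐ(1) and μᵐ⁺¹(1) = μᵐ(1)μᵐ(0) share u u.
  δ-double : ∀ m → δ (suc m) ≤ 2 * δ m
  δ-double m with optimal m
  ... | u , u⊆block₀ , u⊆block₁ , |u|+δ = δ≤ (suc m) (2 * δ m) (u ++ u)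
    (subst (u ++ u ⊆_) (sym (block-suc m false)) (++⁺ u⊆block₀ u⊆block₁))
    (subst (u ++ u ⊆_) (sym (block-suc m true)) (++⁺ u⊆block₁ u⊆block₀))
    (≤-reflexive (begin
      2 * 2 ^ m                       ≡⟨ cong (2 *_) |u|+δ ⟨
      2 * (length u + δ m)            ≡⟨ distrib (length u) (δ m) ⟩
      length u + length u + 2 * δ m   ≡⟨ cong (_+ 2 * δ m) (length-++ u) ⟨
      length (u ++ u) + 2 * δ m       ∎))
    where
    open ≡-Reasoning
    distrib : ∀ l d → 2 * (l + d) ≡ l + l + 2 * d
    distrib = solve-∀

  δ-shift : ∀ m t → δ (t + m) ≤ 2 ^ t * δ m
  δ-shift m zero    = ≤-reflexive (sym (*-identityˡ (δ m)))
  δ-shift m (suc t) = begin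
      δ (suc (t + m))      ≤⟨ δ-double (t + m) ⟩
      2 * δ (t + m)        ≤⟨ *-monoʳ-≤ 2 (δ-shift m t) ⟩
      2 * (2 ^ t * δ m)    ≡⟨ *-assoc 2 (2 ^ t) (δ m) ⟨
      2 ^ suc t * δ m      ∎
    where open ≤-Reasoning

  -- The shifted alignment of μᵐ⁺ᵏ⁺¹(0) = μᵐ⁺¹(μᵏ(0)) with its complement.
  δ-split : ∀ m k → δ (m + suc k) ≤ 2 ^ m + changes (block k false) * δ m
  δ-split m k with optimal m | block-head k false
  ... | u₀ , u₀⊆block₀ , u₀⊆block₁ , |u₀|+δ | x , block≡0x =
    δ≤ (m + suc k) (T + C * δ m) (shifted false x)
       (subst (shifted false x ⊆_) (sym blocks₀) (shifted⊆μ false x))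
       (subst (shifted false x ⊆_) (sym blocks₁) (shifted⊆complement false x))
       (≤-reflexive (sym length-common))
    where
    open Alignment m u₀ u₀⊆block₀ u₀⊆block₁ (δ m) |u₀|+δ
      using (T; shifted; shifted⊆μ; shifted⊆complement; length-shifted)
    open ≡-Reasoning
    C : ℕ
    C = changes (block k false)
    blocks₀ : block (m + suc k) false ≡ μ^ m (μ (false ∷ x))
    blocks₀ = trans (μ^-+ m (suc k) (false ∷ [])) (cong (λ w → μ^ m (μ w)) block≡0x)
    blocks₁ : block (m + suc k) true ≡ μ^ m (μ (complement (false ∷ x)))
    blocks₁ = trans (μ^-+ m (suc k) (true ∷ []))
                    (cong (λ w → μ^ m (μ w)) (trans (block-true k) (cong complement block≡0x)))
    length-common : length (shifted false x) + (T + C * δ m) ≡ 2 ^ (m + suc k)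
    length-common = begin
        length (shifted false x) + (T + C * δ m)
      ≡⟨ cong (λ c → length (shifted false x) + (T + c * δ m)) (cong changes block≡0x) ⟩
        length (shifted false x) + (T + changesFrom false x * δ m)
      ≡⟨ +-assoc (length (shifted false x)) T _ ⟨
        length (shifted false x) + T + changesFrom false x * δ m
      ≡⟨ length-shifted false x ⟩
        length (false ∷ x) * (2 * T)
      ≡⟨ cong (λ w → length w * (2 * T)) block≡0x ⟨
        length (block k false) * (2 * T)
      ≡⟨ cong (_* (2 * T)) (length-block k false) ⟩
        2 ^ k * (2 * T)
      ≡⟨ swap (2 ^ k) T ⟩
        T * 2 ^ suc k
      ≡⟨ ^-distribˡ-+-* 2 m (suc k) ⟨
        2 ^ (m + suc k) ∎
      where
      swap : ∀ K T → K * (2 * T) ≡ T * (2 * K)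
      swap = solve-∀

  -- Doubling a power of two: with N = 2ʲ and Q = 2ᴺ,
  -- δ(2N) ≤ Q + C δ(N) where 3C ≤ Q (C counts the changes of μᴺ⁻¹(0)).
  δ-square : ∀ j → ∃[ C ] (3 * C ≤ 2 ^ (2 ^ j)) × (δ (2 ^ suc j) ≤ 2 ^ (2 ^ j) + C * δ (2 ^ j))
  δ-square j = C , 3C≤Q , subst (λ e → δ e ≤ Q + C * δ N) N+N≡2N (δ-split N k)
    where
    N Q k C : ℕ
    N = 2 ^ j
    Q = 2 ^ N
    k = N ∸ 1
    C = changes (block k false)
    1+k≡N : suc k ≡ N
    1+k≡N = m+[n∸m]≡n (m^n>0 2 j)
    3C≤Q : 3 * C ≤ Q
    3C≤Q = ≤-trans (m≤m+n (3 * C) 1) (subst (λ e → 3 * C + 1 ≤ 2 ^ e) 1+k≡N (changes-block-bound k))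
    N+N≡2N : N + suc k ≡ 2 ^ suc j
    N+N≡2N = trans (cong (N +_) 1+k≡N) (cong (N +_) (sym (+-identityʳ N)))

  -- The rescaled estimate  3ʲ δ(2ʲ) + 16 · 2^(2ʲ)/2ʲ ≤ 17 · 2^(2ʲ), cleared
  -- of denominators; the slack term absorbs the additive Q in δ-square.
  δ-invariant : ∀ j → 6 ^ j * δ (2 ^ j) + 16 * 2 ^ (2 ^ j) ≤ 17 * 2 ^ j * 2 ^ (2 ^ j)
  δ-invariant zero    = +-monoˡ-≤ 32 (≤-trans (≤-reflexive (*-identityˡ (δ 1))) (m∸n≤m 2 (a 1)))
  δ-invariant (suc j) with δ-square j
  ... | C , 3C≤Q , δ2N≤ = subst (λ R → 6 ^ suc j * δ (2 ^ suc j) + 16 * R ≤ 17 * 2 ^ suc j * R)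
                            (sym (2^2^suc j))
                            (invariant-step (6 ^ j) (δ (2 ^ j)) (δ (2 ^ suc j)) C (2 ^ (2 ^ j)) (2 ^ j)
                                            (δ-invariant j) δ2N≤ 3C≤Q (6^suc≤16*2^2^j j))

  δ-at-powers : ∀ j → 3 ^ j * δ (2 ^ j) ≤ 17 * 2 ^ (2 ^ j)
  δ-at-powers j = *-cancelˡ-≤ N {{m^n≢0 2 j}} (begin
      N * (3 ^ j * δ N)     ≡⟨ *-assoc N (3 ^ j) (δ N) ⟨
      N * 3 ^ j * δ N       ≡⟨ cong (_* δ N) (*-^-distrib 2 3 j) ⟨
      6 ^ j * δ N           ≤⟨ m+n≤o⇒m≤o (6 ^ j * δ N) (δ-invariant j) ⟩
      17 * N * Q            ≡⟨ rearrange N Q ⟩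
      N * (17 * Q)          ∎)
    where
    open ≤-Reasoning
    N Q : ℕ
    N = 2 ^ j
    Q = 2 ^ N
    rearrange : ∀ N Q → 17 * N * Q ≡ N * (17 * Q)
    rearrange = solve-∀

  -- Between powers of two, δ at most doubles per step: 3ʲ δ(n) ≤ 17 · 2ⁿ
  -- whenever 2ʲ ≤ n.
  δ-bound : ∀ j n → 2 ^ j ≤ n → 3 ^ j * δ n ≤ 17 * 2 ^ n
  δ-bound j n 2^j≤n = subst (λ e → 3 ^ j * δ e ≤ 17 * 2 ^ e) (m∸n+n≡m 2^j≤n) (begin
      3 ^ j * δ (t + N)              ≤⟨ *-monoʳ-≤ (3 ^ j) (δ-shift N t) ⟩
      3 ^ j * (2 ^ t * δ N)          ≡⟨ x∙yz≈y∙xz (3 ^ j) (2 ^ t) (δ N) ⟩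
      2 ^ t * (3 ^ j * δ N)          ≤⟨ *-monoʳ-≤ (2 ^ t) (δ-at-powers j) ⟩
      2 ^ t * (17 * 2 ^ N)           ≡⟨ x∙yz≈y∙xz (2 ^ t) 17 (2 ^ N) ⟩
      17 * (2 ^ t * 2 ^ N)           ≡⟨ cong (17 *_) (^-distribˡ-+-* 2 t N) ⟨
      17 * 2 ^ (t + N)               ∎)
    where
    open ≤-Reasoning
    N t : ℕ
    N = 2 ^ j
    t = n ∸ N

  a-estimate : ∀ n → 1 ≤ n → PowLog3Bound n ∣ 2 ^ n - a n ∣ (51 * 2 ^ n)
  a-estimate n 1≤n = subst₂ (PowLog3Bound n) (sym (m≤n⇒∣n-m∣≡n∸m (a≤2^n n))) (sym (*-assoc 3 17 (2 ^ n)))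
    (PowLog3Bound-intro n (δ n) (17 * 2 ^ n) ⌊log₂ n ⌋ (n<2^suc⌊log₂n⌋ n)
                        (δ-bound ⌊log₂ n ⌋ n (2^⌊log₂n⌋≤n n 1≤n)))

⌊log₂⌋≡suc⇒1≤ : ∀ L i → ⌊log₂ L ⌋ ≡ suc i → 1 ≤ L
⌊log₂⌋≡suc⇒1≤ zero    i ()
⌊log₂⌋≡suc⇒1≤ (suc L) i _ = s≤s z≤n

tm≡μ^block : ∀ M n → M ≤ n → μ^ n (false ∷ []) ≡ μ^ M (block (n ∸ M) false)
tm≡μ^block M n M≤n = trans (cong (λ e → μ^ e (false ∷ [])) (sym (m+[n∸m]≡n M≤n))) (μ^-+ M (n ∸ M) (false ∷ []))

tmPrefix-blocks : ∀ M n → M ≤ n → tmPrefix n ≡ take n (μ^ M (block (n ∸ M) false))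
tmPrefix-blocks M n M≤n = cong (take n) (tm≡μ^block M n M≤n)

complement-tmPrefix-blocks : ∀ M n → M ≤ n → complement (tmPrefix n) ≡ take n (μ^ M (complement (block (n ∸ M) false)))
complement-tmPrefix-blocks M n M≤n = begin
    complement (take n (μ^ n (false ∷ [])))        ≡⟨ take-map n _ ⟨
    take n (complement (μ^ n (false ∷ [])))        ≡⟨ cong (λ w → take n (complement w)) (tm≡μ^block M n M≤n) ⟩
    take n (complement (μ^ M w))                   ≡⟨ cong (take n) (μ^-complement M w) ⟨
    take n (μ^ M (complement w))                   ∎
  where
  open ≡-Reasoning
  w : Word
  w = block (n ∸ M) false

n≤|blocks| : ∀ M n → M ≤ n → n ≤ length (block (n ∸ M) false) * 2 ^ M
n≤|blocks| M n M≤n = ≤-trans (n≤2^n n) (≤-reflexive (begin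
    2 ^ n                               ≡⟨ cong (2 ^_) (m+[n∸m]≡n M≤n) ⟨
    2 ^ (M + (n ∸ M))                   ≡⟨ ^-distribˡ-+-* 2 M (n ∸ M) ⟩
    2 ^ M * 2 ^ (n ∸ M)                 ≡⟨ *-comm (2 ^ M) (2 ^ (n ∸ M)) ⟩
    2 ^ (n ∸ M) * 2 ^ M                 ≡⟨ cong (_* 2 ^ M) (length-block (n ∸ M) false) ⟨
    length (block (n ∸ M) false) * 2 ^ M ∎))
  where open ≡-Reasoning

module PrefixDeficiency (a : ℕ → ℕ) (lcs-a : ∀ n → IsLCSLength (block n false) (block n true) (a n))
                        (b : ℕ → ℕ) (lcs-b : ∀ n → IsLCSLength (tmPrefix n) (complement (tmPrefix n)) (b n)) where
  open BlockDeficiency a lcs-a using (δ; optimal; δ-at-powers)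

  b≤n : ∀ n → b n ≤ n
  b≤n n with proj₁ (lcs-b n)
  ... | u , (u⊆prefix , _) , |u|≡b = subst (_≤ n) |u|≡b
    (≤-trans (length-mono-≤ u⊆prefix) (≤-trans (≤-reflexive (length-take n _)) (m⊓n≤m n _)))

  prefix-deficiency : ∀ M n → M ≤ n → 2 ^ M * (n ∸ b n) ≤ n * δ M + 2 ^ M * 2 ^ M
  prefix-deficiency M n M≤n with optimal M
  ... | u₀ , u₀⊆block₀ , u₀⊆block₁ , |u₀|+δ
    with Alignment.prefix-alignment M u₀ u₀⊆block₀ u₀⊆block₁ (δ M) |u₀|+δ
           (block (n ∸ M) false) n (n≤|blocks| M n M≤n)
  ... | u , u⊆prefix , u⊆complement , bound = begin
      T * (n ∸ b n)              ≡⟨ *-distribˡ-∸ T n (b n) ⟩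
      T * n ∸ T * b n            ≤⟨ m≤n+o⇒m∸n≤o (T * n) (T * b n) Tn≤ ⟩
      n * δ M + T * T            ∎
    where
    open ≤-Reasoning
    T : ℕ
    T = 2 ^ M
    |u|≤b : length u ≤ b n
    |u|≤b = proj₂ (lcs-b n) u ( subst (u ⊆_) (sym (tmPrefix-blocks M n M≤n)) u⊆prefix
                              , subst (u ⊆_) (sym (complement-tmPrefix-blocks M n M≤n)) u⊆complement)
    Tn≤ : T * n ≤ T * b n + (n * δ M + T * T)
    Tn≤ = ≤-trans bound (≤-trans (≤-reflexive (+-assoc (T * length u) _ _)) (+-monoˡ-≤ _ (*-monoʳ-≤ T |u|≤b)))

  b-power-bound : ∀ i n → 2 ^ (2 ^ suc i) ≤ n → 3 ^ suc i * (n ∸ b n) ≤ 54 * n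
  b-power-bound i n Q≤n = *-cancelˡ-≤ T {{m^n≢0 2 M}} (begin
      T * (3 ^ suc i * X)                              ≡⟨ x∙yz≈y∙xz T (3 ^ suc i) X ⟩
      3 * 3 ^ i * (T * X)                              ≤⟨ *-monoʳ-≤ (3 * 3 ^ i) (prefix-deficiency M n M≤n) ⟩
      3 * 3 ^ i * (n * δ M + T * T)                    ≡⟨ expand (3 ^ i) n (δ M) (T * T) ⟩
      3 * n * (3 ^ i * δ M) + 3 * 3 ^ i * (T * T)      ≤⟨ +-mono-≤ (*-monoʳ-≤ (3 * n) (δ-at-powers i))
                                                                   (*-mono-≤ (*-monoʳ-≤ 3 (3^i≤2^2^i i)) TT≤n) ⟩
      3 * n * (17 * T) + 3 * T * n                     ≡⟨ collect n T ⟩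
      T * (54 * n)                                     ∎)
    where
    open ≤-Reasoning
    M T X : ℕ
    M = 2 ^ i
    T = 2 ^ M
    X = n ∸ b n
    TT≤n : T * T ≤ n
    TT≤n = subst (_≤ n) (2^2^suc i) Q≤n
    M≤n : M ≤ n
    M≤n = ≤-trans (n≤2^n M) (≤-trans (m≤m*n T T {{m^n≢0 2 M}}) TT≤n)
    expand : ∀ y n d S → 3 * y * (n * d + S) ≡ 3 * n * (y * d) + 3 * y * S
    expand = solve-∀
    collect : ∀ n T → 3 * n * (17 * T) + 3 * T * n ≡ T * (54 * n)
    collect = solve-∀

  -- Choosing 2ⁱ⁺¹ ≤ ⌊log₂ n⌋, i.e. i + 1 = ⌊log₂ ⌊log₂ n⌋⌋.
  b-bound : ∀ n → 1 ≤ n → 3 ^ ⌊log₂ ⌊log₂ n ⌋ ⌋ * (n ∸ b n) ≤ 54 * n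
  b-bound n 1≤n with ⌊log₂ ⌊log₂ n ⌋ ⌋ in loglog≡
  ... | zero  = ≤-trans (≤-reflexive (*-identityˡ (n ∸ b n))) (≤-trans (m∸n≤m n (b n)) (m≤m+n n _))
  ... | suc i = b-power-bound i n (≤-trans (^-monoʳ-≤ 2 2^[1+i]≤L) (2^⌊log₂n⌋≤n n 1≤n))
    where
    L : ℕ
    L = ⌊log₂ n ⌋
    2^[1+i]≤L : 2 ^ suc i ≤ L
    2^[1+i]≤L = subst (λ e → 2 ^ e ≤ L) loglog≡ (2^⌊log₂n⌋≤n L (⌊log₂⌋≡suc⇒1≤ L i loglog≡))

  b-estimate : ∀ n → 1 ≤ n → PowLog3Bound ⌊log₂ n ⌋ ∣ n - b n ∣ (162 * n)
  b-estimate n 1≤n = subst₂ (PowLog3Bound ⌊log₂ n ⌋) (sym (m≤n⇒∣n-m∣≡n∸m (b≤n n))) (sym (*-assoc 3 54 n))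
    (PowLog3Bound-intro ⌊log₂ n ⌋ (n ∸ b n) (54 * n) ⌊log₂ ⌊log₂ n ⌋ ⌋ (n<2^suc⌊log₂n⌋ ⌊log₂ n ⌋) (b-bound n 1≤n))

theorem5 : (a b : ℕ → ℕ)
    → (∀ n → IsLCSLength (μ^ n (false ∷ [])) (μ^ n (true ∷ [])) (a n))
    → (∀ n → IsLCSLength (tmPrefix n) (complement (tmPrefix n)) (b n))
    → (∃[ C ] ∃[ N ] ∀ n → N ≤ n → PowLog3Bound n ∣ 2 ^ n - a n ∣ (C * 2 ^ n))
    × (∃[ C ] ∃[ N ] ∀ n → N ≤ n → PowLog3Bound ⌊log₂ n ⌋ ∣ n - b n ∣ (C * n))
theorem5 a b lcs-a lcs-b = (51 , 1 , a-estimate) , (162 , 1 , b-estimate)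
  where
  open BlockDeficiency a lcs-a using (a-estimate)
  open PrefixDeficiency a lcs-a b lcs-b using (b-estimate)
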